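{- Let $\Gamma$ be a finite connected digraph, let $v$ be a vertex of $\Gamma$ and let $A$ be a group of automorphisms of $\Gamma$ acting transitively on the vertices. If $A_v^{+[1]}=A_v^{+[2]}$, then $A_v^{+[1]}=1$.
   Context: A digraph has vertex set and arc set consisting of ordered pairs of distinct vertices. $\Gamma$ is connected if its underlying undirected graph is connected. $A_v$ denotes the stabiliser of $v$ in $A$. For $i\geq1$, $A_v^{+[i]}$ denotes the subgroup of $A_v$ fixing every vertex $u$ for which there is a directed path of length at most $i$ from $v$ to $u$. -}

module Defs where

open import Data.Nat using (ℕ; zero; suc)
open import Data.Fin using (Fin)
open import Data.Bool using (Bool; true; false)
open import Data.Product using (Σ; _×_; ∃-syntax)
open import Data.Fin.Permutation using (Permutation′; _⟨$⟩ʳ_; id; flip; _∘ₚ_; _≈_)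
open import Relation.Binary.PropositionalEquality using (_≡_)
open import Relation.Binary.Construct.Closure.ReflexiveTransitive using (Star)
open import Relation.Binary.Construct.Closure.Symmetric using (SymClosure)

record Digraph (n : ℕ) : Set where
  field
    arc     : Fin n → Fin n → Bool
    loopless : ∀ u → arc u u ≡ false

module _ {n : ℕ} (Γ : Digraph n) where
  open Digraph Γ

  Arc : Fin n → Fin n → Set
  Arc u w = arc u w ≡ true

  Connected : Set
  Connected = ∀ u w → Star (SymClosure Arc) u w

  IsAutomorphism : Permutation′ n → Set
  IsAutomorphism g = ∀ u w → arc (g ⟨$⟩ʳ u) (g ⟨$⟩ʳ w) ≡ arc u w

  record AutGroup : Set₁ where
    field
      Mem       : Permutation′ n → Set
      ∈A-resp   : ∀ {g h} → g ≈ h → Mem g → Mem h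
      ∈A-aut    : ∀ {g} → Mem g → IsAutomorphism g
      ∈A-id     : Mem id
      ∈A-comp   : ∀ {g h} → Mem g → Mem h → Mem (g ∘ₚ h)
      ∈A-inv    : ∀ {g} → Mem g → Mem (flip g)

  VertexTransitive : AutGroup → Set
  VertexTransitive A = ∀ u w → ∃[ g ] (Mem g × g ⟨$⟩ʳ u ≡ w)
    where open AutGroup A

  data Reach≤ : ℕ → Fin n → Fin n → Set where
    here : ∀ {i v} → Reach≤ i v v
    step : ∀ {i v x u} → Arc v x → Reach≤ i x u → Reach≤ (suc i) v u

  FixesBall : ℕ → Fin n → Permutation′ n → Set
  FixesBall i v g = ∀ u → Reach≤ i v u → g ⟨$⟩ʳ u ≡ u

  Stab⁺ : AutGroup → ℕ → Fin n → Permutation′ n → Set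
  Stab⁺ A i v g = AutGroup.Mem A g × FixesBall i v g

-- If h fixes the out-neighbourhood of a vertex x, conjugating h by an element of A
-- carrying v to x and applying A_v^{+[1]} = A_v^{+[2]} shows that h fixes every vertex
-- at directed distance ≤ 2 from x, hence the out-neighbourhood of each out-neighbour
-- of x: membership in the stabiliser A_x^{+[1]} propagates along arcs.  An element of
-- A mapping the tail of an arc to its head has a finite orbit, which traces a directed
-- cycle through the arc; so the connected digraph Γ is strongly connected, and h lies
-- in A_u^{+[1]} for every vertex u, in particular fixes u.
module Submission where

open import Defs
open import Data.Nat using (ℕ; zero; suc; _+_)
open import Data.Nat.GeneralisedArithmetic using (fold; fold-+)
open import Data.Nat.Properties using (n<1+n; +-suc; m≤n⇒∃[o]m+o≡n)
open import Data.Fin using (Fin; toℕ)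
open import Data.Fin.Properties using (pigeonhole)
open import Data.Product using (_×_; _,_; proj₁; proj₂; ∃-syntax)
open import Data.Fin.Permutation
  using (Permutation′; id; _≈_; _⟨$⟩ʳ_; _⟨$⟩ˡ_; flip; _∘ₚ_; inverseˡ; inverseʳ)
open import Function.Base using (_∘_)
open import Function.Bundles using (Injection)
open import Function.Definitions using (Injective)
open import Function.Properties.Inverse using (↔⇒↣)
open import Relation.Binary.PropositionalEquality
open import Relation.Binary.Construct.Closure.ReflexiveTransitive using (Star; ε; _◅_; _◅◅_; return; _⋆)
open import Relation.Binary.Construct.Closure.Symmetric using (SymClosure; fwd; bwd)

Star-preserves : ∀ {A : Set} {T : A → A → Set} (P : A → Set) →
                 (∀ {x y} → T x y → P x → P y) → ∀ {x y} → Star T x y → P x → P y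
Star-preserves P preserves ε        p = p
Star-preserves P preserves (t ◅ ts) p = Star-preserves P preserves ts (preserves t p)

fold-injective : ∀ {A : Set} {s : A → A} → Injective _≡_ _≡_ s →
                 ∀ k {x y} → fold x s k ≡ fold y s k → x ≡ y
fold-injective s-inj zero    eq = eq
fold-injective s-inj (suc k) eq = fold-injective s-inj k (s-inj eq)

module _ {n : ℕ} (π : Permutation′ n) where

  ⟨$⟩ʳ-injective : Injective _≡_ _≡_ (π ⟨$⟩ʳ_)
  ⟨$⟩ʳ-injective = Injection.injective (↔⇒↣ π)

  orbit : Fin n → ℕ → Fin n
  orbit x k = fold x (π ⟨$⟩ʳ_) k

  -- Two of the n + 1 points x, π x, …, πⁿ x coincide, say πⁱ x = πʲ x with i < j;
  -- cancelling πⁱ gives π^(j - i) x = x.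
  orbit-returns : ∀ x → ∃[ e ] orbit x (suc e) ≡ x
  orbit-returns x with pigeonhole (n<1+n n) (orbit x ∘ toℕ)
  ... | i , j , i<j , orbit-i≡orbit-j with m≤n⇒∃[o]m+o≡n i<j
  ... | e , i+1+e≡j = e , fold-injective ⟨$⟩ʳ-injective (toℕ i) (sym (begin
        orbit x (toℕ i)                  ≡⟨ orbit-i≡orbit-j ⟩
        orbit x (toℕ j)                  ≡⟨ cong (orbit x) (sym i+1+e≡j) ⟩
        orbit x (suc (toℕ i + e))        ≡⟨ cong (orbit x) (sym (+-suc (toℕ i) e)) ⟩
        orbit x (toℕ i + suc e)          ≡⟨ fold-+ x (π ⟨$⟩ʳ_) (toℕ i) ⟩
        fold (orbit x (suc e)) (π ⟨$⟩ʳ_) (toℕ i) ∎))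
    where open ≡-Reasoning

conjugate : ∀ {n} → Permutation′ n → Permutation′ n → Permutation′ n
conjugate a h = a ∘ₚ h ∘ₚ flip a

module _ {n : ℕ} (Γ : Digraph n) where

  reach-aut : ∀ g → IsAutomorphism Γ g →
              ∀ {i x u} → Reach≤ Γ i x u → Reach≤ Γ i (g ⟨$⟩ʳ x) (g ⟨$⟩ʳ u)
  reach-aut g g-aut here       = here
  reach-aut g g-aut (step e r) = step (trans (g-aut _ _) e) (reach-aut g g-aut r)

  fixesBall-arc : ∀ {i x y h} → Arc Γ x y → FixesBall Γ (suc i) x h → FixesBall Γ i y h
  fixesBall-arc e fix u r = fix u (step e r)

  orbit-arc : ∀ g {x} → IsAutomorphism Γ g → Arc Γ x (g ⟨$⟩ʳ x) →
              ∀ k → Arc Γ (orbit g x k) (orbit g x (suc k))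
  orbit-arc g g-aut e zero    = e
  orbit-arc g g-aut e (suc k) = trans (g-aut _ _) (orbit-arc g g-aut e k)

  orbit-path : ∀ g {x} → IsAutomorphism Γ g → Arc Γ x (g ⟨$⟩ʳ x) →
               ∀ k → Star (Arc Γ) (g ⟨$⟩ʳ x) (orbit g x (suc k))
  orbit-path g g-aut e zero    = ε
  orbit-path g g-aut e (suc k) = orbit-path g g-aut e k ◅◅ return (orbit-arc g g-aut e (suc k))

module _ {n : ℕ} {Γ : Digraph n} (A : AutGroup Γ) where
  open AutGroup A

  arc-on-cycle : VertexTransitive Γ A → ∀ {x y} → Arc Γ x y → Star (Arc Γ) y x
  arc-on-cycle tr {x} {y} e with tr x y
  ... | a , a∈A , refl with orbit-returns a x
  ... | k , returns = subst (Star (Arc Γ) _) returns (orbit-path Γ a (∈A-aut a∈A) e k)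

  strongly-connected : VertexTransitive Γ A → Connected Γ → ∀ u w → Star (Arc Γ) u w
  strongly-connected tr conn u w = (undirect ⋆) (conn u w)
    where
    undirect : ∀ {x y} → SymClosure (Arc Γ) x y → Star (Arc Γ) x y
    undirect (fwd e) = return e
    undirect (bwd e) = arc-on-cycle tr e

  Stab⁺-conjugate : ∀ a h {i x} → Mem a →
                    Stab⁺ Γ A i (a ⟨$⟩ʳ x) h → Stab⁺ Γ A i x (conjugate a h)
  Stab⁺-conjugate a h a∈A (h∈A , fix) =
    ∈A-comp (∈A-comp a∈A h∈A) (∈A-inv a∈A) ,
    λ _ r → trans (cong (a ⟨$⟩ˡ_) (fix _ (reach-aut Γ a (∈A-aut a∈A) r))) (inverseˡ a)

  fixesBall-unconjugate : ∀ a h {i x} → Mem a →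
                          FixesBall Γ i x (conjugate a h) → FixesBall Γ i (a ⟨$⟩ʳ x) h
  fixesBall-unconjugate a h {i} {x} a∈A fix w r = begin
    h ⟨$⟩ʳ w                              ≡⟨ sym (inverseʳ a) ⟩
    a ⟨$⟩ʳ (a ⟨$⟩ˡ (h ⟨$⟩ʳ w))             ≡⟨ cong (λ z → a ⟨$⟩ʳ (a ⟨$⟩ˡ (h ⟨$⟩ʳ z))) (sym (inverseʳ a)) ⟩
    a ⟨$⟩ʳ (conjugate a h ⟨$⟩ʳ (a ⟨$⟩ˡ w)) ≡⟨ cong (a ⟨$⟩ʳ_) (fix _ pulled-back) ⟩
    a ⟨$⟩ʳ (a ⟨$⟩ˡ w)                     ≡⟨ inverseʳ a ⟩
    w                                     ∎
    where
    open ≡-Reasoning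
    pulled-back : Reach≤ Γ i x (a ⟨$⟩ˡ w)
    pulled-back = subst (λ z → Reach≤ Γ i z _) (inverseˡ a) (reach-aut Γ (flip a) (∈A-aut (∈A-inv a∈A)) r)

  Stab⁺-⊆-transfer : VertexTransitive Γ A → ∀ {i j v} →
                     (∀ g → Stab⁺ Γ A i v g → Stab⁺ Γ A j v g) →
                     ∀ x h → Stab⁺ Γ A i x h → Stab⁺ Γ A j x h
  Stab⁺-⊆-transfer tr {v = v} ⊆ᵥ x h h∈ with tr v x
  ... | a , a∈A , refl =
    proj₁ h∈ , fixesBall-unconjugate a h a∈A (proj₂ (⊆ᵥ _ (Stab⁺-conjugate a h a∈A h∈)))

lemma3p3 : (n : ℕ) (Γ : Digraph n) → Connected Γ → (v : Fin n) (A : AutGroup Γ) → VertexTransitive Γ A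
    → (∀ g → (Stab⁺ Γ A 1 v g → Stab⁺ Γ A 2 v g) × (Stab⁺ Γ A 2 v g → Stab⁺ Γ A 1 v g))
    → ∀ g → Stab⁺ Γ A 1 v g → g ≈ id
lemma3p3 n Γ conn v A tr H g g∈ u =
  proj₂ (Star-preserves (λ x → Stab⁺ Γ A 1 x g) along-arc (strongly-connected A tr conn v u) g∈) u here
  where
  along-arc : ∀ {x y} → Arc Γ x y → Stab⁺ Γ A 1 x g → Stab⁺ Γ A 1 y g
  along-arc e g∈ₓ with Stab⁺-⊆-transfer A tr (proj₁ ∘ H) _ g g∈ₓ
  ... | g∈A , fixes-ball₂ = g∈A , fixesBall-arc Γ {h = g} e fixes-ball₂
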